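{- Let $R$ denote the flipping game algorithm. For any sequence $\sigma$ of operations and any algorithm $A\in\mathcal{F}$, $c(R,\sigma)\le 2\,c(A,\sigma)$, where the initial graph may be arbitrary (possibly non-empty) but $R$ and $A$ start from the same edge orientation.
   Context: Setting: a dynamic graph in which each vertex holds a value; operations are edge insertions/deletions, changes of a vertex's value, and queries at a vertex $v$ (which compute a fixed function of the values of $v$ and its neighbors). $\mathcal{F}$ is the family of algorithms that maintain an orientation of the edges, where each vertex stores the current values of its in-neighbors; when the value of $v$ changes, $v$ sends it to all its out-neighbors; when $v$ is queried, it collects the values of its out-neighbors. Such an algorithm may flip edges; flipping an edge outgoing of $v$ costs $0$ if done during a query or update at $v$, and $1$ otherwise. The cost of $A\in\mathcal{F}$ on $\sigma$ is $c(A,\sigma)=t+f+\sum_{op}\mathrm{outdeg}(v_{op})$, where $t$ is the number of edge insertions and deletions in $\sigma$, $f$ is the total cost of the flips $A$ performs, and the sum ranges over all vertex updates and queries $op$ in $\sigma$, with $v_{op}$ the vertex it applies to and $\mathrm{outdeg}(v_{op})$ its outdegree (in $A$'s orientation) at that operation. The flipping game $R\in\mathcal{F}$ resets $v$ (flips all outgoing edges of $v$ to become incoming) whenever a query or update is applied to $v$. -}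

module Defs where

open import Data.Nat using (ℕ; zero; suc; _+_)
open import Data.Bool using (Bool; true; false; if_then_else_; _∨_)
open import Data.Fin using (Fin; _≟_)
open import Data.List using (List; []; _∷_; map; allFin)
open import Data.Nat.ListAction using (sum)
open import Data.Product using (_×_)
open import Data.Maybe using (Maybe; just; nothing)
open import Relation.Nullary using (yes; no; ¬_)
open import Relation.Binary.PropositionalEquality using (_≡_)

-- An orientation of a simple graph on vertex set Fin n:
-- O u w ≡ true  means the edge {u,w} is present and oriented u → w.
Orient : ℕ → Set
Orient n = Fin n → Fin n → Bool

WellFormed : ∀ {n} → Orient n → Set
WellFormed {n} O =
  ((u : Fin n) → O u u ≡ false) × ((u w : Fin n) → O u w ≡ true → O w u ≡ false)

data Op (n : ℕ) : Set where
  ins : Fin n → Fin n → Op n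
  del : Fin n → Fin n → Op n
  upd : Fin n → Op n
  qry : Fin n → Op n

outdeg : ∀ {n} → Orient n → Fin n → ℕ
outdeg {n} O v = sum (map (λ w → if O v w then 1 else 0) (allFin n))

addEdge : ∀ {n} → Orient n → Fin n → Fin n → Orient n
addEdge O u w x y with x ≟ u | y ≟ w
... | yes _ | yes _ = true
... | _     | _     = O x y

delEdge : ∀ {n} → Orient n → Fin n → Fin n → Orient n
delEdge O u w x y with x ≟ u | y ≟ w | x ≟ w | y ≟ u
... | yes _ | yes _ | _     | _     = false
... | _     | _     | yes _ | yes _ = false
... | _     | _     | _     | _     = O x y

flipEdge : ∀ {n} → Orient n → Fin n → Fin n → Orient n
flipEdge O u w = addEdge (delEdge O u w) w u

-- reset v: every outgoing edge of v becomes incoming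
reset : ∀ {n} → Orient n → Fin n → Orient n
reset O v x y with x ≟ v | y ≟ v
... | yes _ | _     = false
... | no _  | yes _ = O x y ∨ O v x
... | no _  | no _  = O x y

-- cost of flipping an edge outgoing of u, given the vertex of the
-- operation currently being processed (just v if the last operation of σ
-- processed so far is an update/query at v, nothing otherwise)
flipCost : ∀ {n} → Maybe (Fin n) → Fin n → ℕ
flipCost nothing  u = 1
flipCost (just v) u with v ≟ u
... | yes _ = 0
... | no _  = 1

-- orientation chosen for an inserted edge {u,w}: true = u → w, false = w → u
orientIns : ∀ {n} → Orient n → Fin n → Fin n → Bool → Orient n
orientIns O u w true  = addEdge O u w
orientIns O u w false = addEdge O w u

-- RunA O c σ k : an execution of some algorithm A ∈ 𝓕 on the remaining
-- sequence σ, starting from orientation O with "current operation vertex" c,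
-- of total cost k.  A may flip any existing edge at any moment (paid by
-- flipCost), chooses the orientation of inserted edges, and pays the
-- outdegree of v (at the moment of the operation) for updates/queries at v.
data RunA {n : ℕ} : Orient n → Maybe (Fin n) → List (Op n) → ℕ → Set where
  done : ∀ {O c} → RunA O c [] 0
  flip : ∀ {O c σ k} (u w : Fin n) → O u w ≡ true →
         RunA (flipEdge O u w) c σ k → RunA O c σ (flipCost c u + k)
  ins  : ∀ {O c σ k} (u w : Fin n) (b : Bool) → ¬ (u ≡ w) →
         O u w ≡ false → O w u ≡ false →
         RunA (orientIns O u w b) nothing σ k → RunA O c (ins u w ∷ σ) (1 + k)
  del  : ∀ {O c σ k} (u w : Fin n) → (O u w ∨ O w u) ≡ true →
         RunA (delEdge O u w) nothing σ k → RunA O c (del u w ∷ σ) (1 + k)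
  upd  : ∀ {O c σ k} (v : Fin n) →
         RunA O (just v) σ k → RunA O c (upd v ∷ σ) (outdeg O v + k)
  qry  : ∀ {O c σ k} (v : Fin n) →
         RunA O (just v) σ k → RunA O c (qry v ∷ σ) (outdeg O v + k)

-- RunR O σ k : an execution of the flipping game R on σ from orientation O
-- with total cost k.  R resets v (for free) at every update/query at v,
-- never flips otherwise; inserted edges are oriented arbitrarily (b).
data RunR {n : ℕ} : Orient n → List (Op n) → ℕ → Set where
  done : ∀ {O} → RunR O [] 0
  ins  : ∀ {O σ k} (u w : Fin n) (b : Bool) → ¬ (u ≡ w) →
         O u w ≡ false → O w u ≡ false →
         RunR (orientIns O u w b) σ k → RunR O (ins u w ∷ σ) (1 + k)
  del  : ∀ {O σ k} (u w : Fin n) → (O u w ∨ O w u) ≡ true →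
         RunR (delEdge O u w) σ k → RunR O (del u w ∷ σ) (1 + k)
  upd  : ∀ {O σ k} (v : Fin n) →
         RunR (reset O v) σ k → RunR O (upd v ∷ σ) (outdeg O v + k)
  qry  : ∀ {O σ k} (v : Fin n) →
         RunR (reset O v) σ k → RunR O (qry v ∷ σ) (outdeg O v + k)

module Submission where

-- Potential.  Φ(R, A) is the number of ordered pairs (x, y) such that the
-- edge {x, y} is oriented x → y by R but not by A.
--
-- While R and A process the same sequence, they orient the same
-- set of edges (SameEdges), and right after an update/query at v the
-- vertex v has no outgoing edge in R, since R has just reset it (Drained).
--
-- For every step, cost of R + ΔΦ ≤ 2 · cost of A:
--   * A flips u → w: Φ grows by at most [R has u → w], which is 0 when the
--     flip is free (it happens during an operation at u, so u is drained);
--   * insertion: Φ grows by at most 1; deletion: Φ does not grow;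
--   * update/query at v: the out-edges of v in R are paid either by
--     outdeg_A(v) (agreeing edges) or by the decrease of Φ (disagreeing
--     ones), and the reset creates at most outdeg_A(v) new disagreements.
-- Summing over the run gives c(R) ≤ 2 c(A) + Φ(O₀, O₀) = 2 c(A).

open import Defs
open import Algebra.Bundles using (CommutativeMonoid)
open import Data.Nat using (ℕ; zero; suc; _+_; _*_; _≤_; z≤n)
open import Data.Nat.Properties
  using (+-0-commutativeMonoid; +-commutativeSemigroup; +-mono-≤; +-monoʳ-≤; +-identityʳ; ≤-refl; ≤-trans;
         ≤-reflexive; m≤m+n; m≤n+m; module ≤-Reasoning)
open import Data.Nat.Tactic.RingSolver using (solve-∀)
import Data.Nat.ListAction as List
open import Data.List using (List; tabulate)
open import Data.List.Properties using (map-tabulate)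
open import Data.Fin using (Fin; _≟_; punchIn) renaming (zero to fzero; suc to fsuc)
open import Data.Fin.Properties using (punchInᵢ≢i)
open import Data.Bool using (Bool; true; false; if_then_else_; _∧_; _∨_; not)
open import Data.Bool.Properties
  using (∨-comm; ∧-comm; ∨-identityʳ; ∨-zeroʳ; ∧-inverseʳ; ∧-distribˡ-∨; ∨-commutativeMonoid)
open import Data.Maybe using (Maybe; just; nothing)
open import Data.Product using (_×_; _,_)
open import Data.Unit using (⊤; tt)
open import Data.Empty using (⊥-elim)
open import Relation.Nullary using (does; yes; no)
open import Relation.Binary.PropositionalEquality
  using (_≡_; _≢_; refl; sym; trans; cong; cong₂; subst; subst₂; module ≡-Reasoning)
open import Algebra.Properties.CommutativeMonoid.Sum +-0-commutativeMonoid
  using (sum; sum-cong-≗; ∑-distrib-+; sum-remove; sum-replicate-zero)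
open import Algebra.Properties.CommutativeSemigroup
  (CommutativeMonoid.commutativeSemigroup ∨-commutativeMonoid)
  using () renaming (interchange to ∨-interchange)
open import Algebra.Properties.CommutativeSemigroup +-commutativeSemigroup
  using () renaming (x∙yz≈y∙xz to +-shuffle)

_when_ : ℕ → Bool → ℕ
m when b = if b then m else 0

𝟙 : Bool → ℕ
𝟙 b = 1 when b

𝟙≤1 : ∀ b → 𝟙 b ≤ 1
𝟙≤1 true  = ≤-refl
𝟙≤1 false = z≤n

_=?_ : ∀ {n} → Fin n → Fin n → Bool
x =? y = does (x ≟ y)

=?-refl : ∀ {n} (x : Fin n) → (x =? x) ≡ true
=?-refl x with x ≟ x
... | yes _  = refl
... | no x≢x = ⊥-elim (x≢x refl)

=?-≢ : ∀ {n} {x y : Fin n} → x ≢ y → (x =? y) ≡ false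
=?-≢ {x = x} {y} x≢y with x ≟ y
... | yes x≡y = ⊥-elim (x≢y x≡y)
... | no _    = refl

=?-sound : ∀ {n} {x y : Fin n} → (x =? y) ≡ true → x ≡ y
=?-sound {x = x} {y} _ with x ≟ y
... | yes x≡y = x≡y
=?-sound () | no _

∑-mono : ∀ {n} {f g : Fin n → ℕ} → (∀ x → f x ≤ g x) → sum f ≤ sum g
∑-mono {zero}  f≤g = z≤n
∑-mono {suc n} f≤g = +-mono-≤ (f≤g fzero) (∑-mono (λ x → f≤g (fsuc x)))

∑-zero : ∀ {n} {f : Fin n → ℕ} → (∀ x → f x ≡ 0) → sum f ≡ 0
∑-zero {n} f≡0 = trans (sum-cong-≗ f≡0) (sum-replicate-zero n)

∑-single : ∀ {n} (v : Fin n) (f : Fin n → ℕ) → (∀ x → x ≢ v → f x ≡ 0) → sum f ≡ f v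
∑-single {suc n} v f vanish = begin
  sum f                             ≡⟨ sum-remove f ⟩
  f v + sum (λ x → f (punchIn v x)) ≡⟨ cong (f v +_) (∑-zero (λ x → vanish _ (punchInᵢ≢i v x))) ⟩
  f v + 0                           ≡⟨ +-identityʳ (f v) ⟩
  f v                               ∎
  where open ≡-Reasoning

∑-at : ∀ {n} (v : Fin n) (f : Fin n → ℕ) → sum (λ x → f x when (x =? v)) ≡ f v
∑-at v f = trans (∑-single v _ (λ x x≢v → cong (f x when_) (=?-≢ x≢v)))
                 (cong (f v when_) (=?-refl v))

∑-when : ∀ {n} (b : Bool) (f : Fin n → ℕ) → sum (λ x → f x when b) ≡ sum f when b
∑-when         true  f = refl
∑-when {n = n} false f = ∑-zero {n} {λ _ → 0} (λ _ → refl)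

∑₂ : ∀ {n} → (Fin n → Fin n → ℕ) → ℕ
∑₂ f = sum (λ x → sum (λ y → f x y))

∑₂-mono : ∀ {n} {f g : Fin n → Fin n → ℕ} → (∀ x y → f x y ≤ g x y) → ∑₂ f ≤ ∑₂ g
∑₂-mono f≤g = ∑-mono (λ x → ∑-mono (f≤g x))

∑₂-+ : ∀ {n} (f g : Fin n → Fin n → ℕ) → ∑₂ (λ x y → f x y + g x y) ≡ ∑₂ f + ∑₂ g
∑₂-+ f g = trans (sum-cong-≗ (λ x → ∑-distrib-+ (f x) (g x)))
                 (∑-distrib-+ (λ x → sum (f x)) (λ x → sum (g x)))

∑₂-row : ∀ {n} (v : Fin n) (f : Fin n → Fin n → ℕ) →
         ∑₂ (λ x y → f x y when (x =? v)) ≡ sum (f v)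
∑₂-row v f = trans (sum-cong-≗ (λ x → ∑-when (x =? v) (f x))) (∑-at v (λ x → sum (f x)))

∑₂-column : ∀ {n} (v : Fin n) (f : Fin n → Fin n → ℕ) →
            ∑₂ (λ x y → f y x when (y =? v)) ≡ sum (f v)
∑₂-column v f = sum-cong-≗ (λ x → ∑-at v (λ y → f y x))

outdeg-∑ : ∀ {n} (O : Orient n) v → outdeg O v ≡ sum (λ w → 𝟙 (O v w))
outdeg-∑ O v = trans (cong List.sum (map-tabulate (λ w → w) (λ w → 𝟙 (O v w))))
                     (tabulate-∑ (λ w → 𝟙 (O v w)))
  where
  tabulate-∑ : ∀ {m} (f : Fin m → ℕ) → List.sum (tabulate f) ≡ sum f
  tabulate-∑ {zero}  f = refl
  tabulate-∑ {suc m} f = cong (f fzero +_) (tabulate-∑ (λ x → f (fsuc x)))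

at : ∀ {n} → Fin n → Fin n → Fin n → Fin n → Bool
at u w x y = (x =? u) ∧ (y =? w)

on : ∀ {n} → Fin n → Fin n → Fin n → Fin n → Bool
on u w x y = at u w x y ∨ at w u x y

on-swap : ∀ {n} (u w x y : Fin n) → on u w y x ≡ on u w x y
on-swap u w x y = trans (cong₂ _∨_ (∧-comm (y =? u) (x =? w)) (∧-comm (y =? w) (x =? u)))
                        (∨-comm (at w u x y) (at u w x y))

on-sym : ∀ {n} (u w x y : Fin n) → on w u x y ≡ on u w x y
on-sym u w x y = ∨-comm (at w u x y) (at u w x y)

addEdge-char : ∀ {n} (O : Orient n) u w x y → addEdge O u w x y ≡ at u w x y ∨ O x y
addEdge-char O u w x y with x ≟ u | y ≟ w
... | yes _ | yes _ = refl
... | yes _ | no _  = refl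
... | no _  | _     = refl

delEdge-char : ∀ {n} (O : Orient n) u w x y → delEdge O u w x y ≡ not (on u w x y) ∧ O x y
delEdge-char O u w x y with x ≟ u | y ≟ w | x ≟ w | y ≟ u
... | yes _ | yes _ | _     | _     = refl
... | yes _ | no _  | yes _ | yes _ = refl
... | yes _ | no _  | yes _ | no _  = refl
... | yes _ | no _  | no _  | _     = refl
... | no _  | _     | yes _ | yes _ = refl
... | no _  | _     | yes _ | no _  = refl
... | no _  | _     | no _  | _     = refl

flipEdge-char : ∀ {n} (O : Orient n) u w x y →
                flipEdge O u w x y ≡ at w u x y ∨ (not (on u w x y) ∧ O x y)
flipEdge-char O u w x y =
  trans (addEdge-char (delEdge O u w) w u x y) (cong (at w u x y ∨_) (delEdge-char O u w x y))

orientIns-grows : ∀ {n} (O : Orient n) u w b {x y} → O x y ≡ true → orientIns O u w b x y ≡ true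
orientIns-grows O u w true  {x} {y} Oxy =
  trans (addEdge-char O u w x y) (subst (λ t → at u w x y ∨ t ≡ true) (sym Oxy) (∨-zeroʳ _))
orientIns-grows O u w false {x} {y} Oxy =
  trans (addEdge-char O w u x y) (subst (λ t → at w u x y ∨ t ≡ true) (sym Oxy) (∨-zeroʳ _))

skel : ∀ {n} → Orient n → Fin n → Fin n → Bool
skel O x y = O x y ∨ O y x

skel-addEdge : ∀ {n} (O : Orient n) u w x y → skel (addEdge O u w) x y ≡ on u w x y ∨ skel O x y
skel-addEdge O u w x y = begin
  addEdge O u w x y ∨ addEdge O u w y x         ≡⟨ cong₂ _∨_ (addEdge-char O u w x y) (addEdge-char O u w y x) ⟩
  (at u w x y ∨ O x y) ∨ (at u w y x ∨ O y x)   ≡⟨ ∨-interchange (at u w x y) (O x y) (at u w y x) (O y x) ⟩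
  (at u w x y ∨ at u w y x) ∨ skel O x y        ≡⟨ cong (λ t → (at u w x y ∨ t) ∨ skel O x y) (∧-comm (y =? u) (x =? w)) ⟩
  on u w x y ∨ skel O x y                       ∎
  where open ≡-Reasoning

skel-orientIns : ∀ {n} (O : Orient n) u w b x y → skel (orientIns O u w b) x y ≡ on u w x y ∨ skel O x y
skel-orientIns O u w true  x y = skel-addEdge O u w x y
skel-orientIns O u w false x y =
  trans (skel-addEdge O w u x y) (cong (_∨ skel O x y) (on-sym u w x y))

skel-delEdge : ∀ {n} (O : Orient n) u w x y → skel (delEdge O u w) x y ≡ not (on u w x y) ∧ skel O x y
skel-delEdge O u w x y = begin
  delEdge O u w x y ∨ delEdge O u w y x                       ≡⟨ cong₂ _∨_ (delEdge-char O u w x y) (delEdge-char O u w y x) ⟩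
  (not (on u w x y) ∧ O x y) ∨ (not (on u w y x) ∧ O y x)     ≡⟨ cong (λ t → (not (on u w x y) ∧ O x y) ∨ (not t ∧ O y x)) (on-swap u w x y) ⟩
  (not (on u w x y) ∧ O x y) ∨ (not (on u w x y) ∧ O y x)     ≡⟨ sym (∧-distribˡ-∨ (not (on u w x y)) (O x y) (O y x)) ⟩
  not (on u w x y) ∧ skel O x y                               ∎
  where open ≡-Reasoning

at-sound : ∀ {n} {u w x y : Fin n} → at u w x y ≡ true → x ≡ u × y ≡ w
at-sound {u = u} {w} {x} {y} _ with x =? u in xu | y =? w in yw
... | true  | true  = =?-sound xu , =?-sound yw
at-sound () | true  | false
at-sound () | false | _

on-skel : ∀ {n} (O : Orient n) {u w} x y → O u w ≡ true → on u w x y ≡ true → skel O x y ≡ true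
on-skel O {u} {w} x y Ouw onxy with at u w x y in atuw
... | true  with at-sound {u = u} {w} {x} {y} atuw
...   | refl , refl = cong (_∨ O w u) Ouw
on-skel O {u} {w} x y Ouw onxy | false with at-sound {u = w} {u} {x} {y} onxy
...   | refl , refl = trans (cong (O w u ∨_) Ouw) (∨-zeroʳ (O w u))

skel-flipEdge : ∀ {n} (O : Orient n) u w x y → O u w ≡ true → skel (flipEdge O u w) x y ≡ skel O x y
skel-flipEdge O u w x y Ouw = begin
  skel (flipEdge O u w) x y                 ≡⟨ skel-addEdge (delEdge O u w) w u x y ⟩
  on w u x y ∨ skel (delEdge O u w) x y     ≡⟨ cong₂ _∨_ (on-sym u w x y) (skel-delEdge O u w x y) ⟩
  on u w x y ∨ (not (on u w x y) ∧ skel O x y) ≡⟨ absorb (on u w x y) (skel O x y) (on-skel O x y Ouw) ⟩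
  skel O x y                                ∎
  where
  open ≡-Reasoning
  absorb : ∀ o s → (o ≡ true → s ≡ true) → o ∨ (not o ∧ s) ≡ s
  absorb true  s o⇒s = sym (o⇒s refl)
  absorb false s _   = refl

skel-reset : ∀ {n} (O : Orient n) v {x y} → x ≢ y → skel (reset O v) x y ≡ skel O x y
skel-reset O v {x} {y} x≢y with x ≟ v | y ≟ v
... | yes refl | yes refl = ⊥-elim (x≢y refl)
... | yes refl | no _     = ∨-comm (O y x) (O x y)
... | no _     | yes refl = ∨-identityʳ (O x y ∨ O y x)
... | no _     | no _     = refl

reset-drains : ∀ {n} (O : Orient n) v y → reset O v v y ≡ false
reset-drains O v y with v ≟ v
... | yes _  = refl
... | no v≢v = ⊥-elim (v≢v refl)

disagree : ∀ {n} → Orient n → Orient n → Fin n → Fin n → ℕ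
disagree R A x y = 𝟙 (R x y ∧ not (A x y))

Φ : ∀ {n} → Orient n → Orient n → ℕ
Φ R A = ∑₂ (disagree R A)

Φ-self : ∀ {n} (O : Orient n) → Φ O O ≡ 0
Φ-self O = ∑-zero (λ x → ∑-zero (λ y → cong 𝟙 (∧-inverseʳ (O x y))))

∑₂-at : ∀ {n} (u w : Fin n) (f : Fin n → Fin n → ℕ) → ∑₂ (λ x y → f x y when at u w x y) ≡ f u w
∑₂-at u w f = begin
  ∑₂ (λ x y → f x y when at u w x y)               ≡⟨ sum-cong-≗ (λ x → sum-cong-≗ (λ y → when-∧ (f x y) (x =? u) (y =? w))) ⟩
  ∑₂ (λ x y → (f x y when (y =? w)) when (x =? u)) ≡⟨ ∑₂-row u (λ x y → f x y when (y =? w)) ⟩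
  sum (λ y → f u y when (y =? w))                  ≡⟨ ∑-at w (f u) ⟩
  f u w                                            ∎
  where
  open ≡-Reasoning
  when-∧ : ∀ m a b → m when (a ∧ b) ≡ (m when b) when a
  when-∧ m true  b = refl
  when-∧ m false b = refl

Φ-local : ∀ {n} {R A R′ A′ : Orient n} (u w : Fin n) (f : Fin n → Fin n → ℕ) →
          (∀ x y → disagree R′ A′ x y ≤ disagree R A x y + (f x y when at u w x y)) →
          Φ R′ A′ ≤ Φ R A + f u w
Φ-local {R = R} {A} u w f pointwise =
  ≤-trans (∑₂-mono pointwise)
          (≤-reflexive (trans (∑₂-+ (disagree R A) _) (cong (Φ R A +_) (∑₂-at u w f))))

-- A flips u → w: only the pair (u, w) can become a disagreement, and only
-- if R has the edge u → w.
Φ-flipEdge : ∀ {n} (R A : Orient n) u w → Φ R (flipEdge A u w) ≤ Φ R A + 𝟙 (R u w)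
Φ-flipEdge R A u w = Φ-local {R = R} {A} {R} {flipEdge A u w} u w (λ x y → 𝟙 (R x y)) (λ x y →
  subst (λ t → 𝟙 (R x y ∧ not t) ≤ disagree R A x y + (𝟙 (R x y) when at u w x y))
        (sym (flipEdge-char A u w x y))
        (flip-bound (at u w x y) (at w u x y) (R x y) (A x y)))
  where
  flip-bound : ∀ a b r s → 𝟙 (r ∧ not (b ∨ (not (a ∨ b) ∧ s))) ≤ 𝟙 (r ∧ not s) + (𝟙 r when a)
  flip-bound true  b     false s = z≤n
  flip-bound true  b     true  s = ≤-trans (𝟙≤1 _) (m≤n+m 1 _)
  flip-bound false true  false s = z≤n
  flip-bound false true  true  s = z≤n
  flip-bound false false r     s = m≤m+n _ 0

-- R inserts s → t while A only gains edges: at most the pair (s, t) is new.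
Φ-addEdge : ∀ {n} (R A A′ : Orient n) s t → (∀ x y → A x y ≡ true → A′ x y ≡ true) →
            Φ (addEdge R s t) A′ ≤ Φ R A + 1
Φ-addEdge R A A′ s t A⊆A′ = Φ-local {R = R} {A} {addEdge R s t} {A′} s t (λ _ _ → 1) (λ x y →
  subst (λ t′ → 𝟙 (t′ ∧ not (A′ x y)) ≤ disagree R A x y + (1 when at s t x y))
        (sym (addEdge-char R s t x y))
        (insert-bound (at s t x y) (R x y) (A x y) (A′ x y) (A⊆A′ x y)))
  where
  insert-bound : ∀ a r p p′ → (p ≡ true → p′ ≡ true) → 𝟙 ((a ∨ r) ∧ not p′) ≤ 𝟙 (r ∧ not p) + (1 when a)
  insert-bound true  r     p     p′ _   = ≤-trans (𝟙≤1 _) (m≤n+m 1 _)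
  insert-bound false false p     p′ _   = z≤n
  insert-bound false true  false p′ _   = 𝟙≤1 _
  insert-bound false true  true  p′ p⇒p′ rewrite p⇒p′ refl = z≤n

Φ-orientIns : ∀ {n} (R A : Orient n) u w b′ b → Φ (orientIns R u w b′) (orientIns A u w b) ≤ Φ R A + 1
Φ-orientIns R A u w true  b = Φ-addEdge R A (orientIns A u w b) u w (λ _ _ → orientIns-grows A u w b)
Φ-orientIns R A u w false b = Φ-addEdge R A (orientIns A u w b) w u (λ _ _ → orientIns-grows A u w b)

Φ-delEdge : ∀ {n} (R A : Orient n) u w → Φ (delEdge R u w) (delEdge A u w) ≤ Φ R A
Φ-delEdge R A u w = ∑₂-mono (λ x y →
  subst₂ (λ r s → 𝟙 (r ∧ not s) ≤ disagree R A x y)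
         (sym (delEdge-char R u w x y)) (sym (delEdge-char A u w x y))
         (delete-bound (on u w x y) (R x y) (A x y)))
  where
  delete-bound : ∀ o r s → 𝟙 ((not o ∧ r) ∧ not (not o ∧ s)) ≤ 𝟙 (r ∧ not s)
  delete-bound true  r s = z≤n
  delete-bound false r s = ≤-refl

SameEdges : ∀ {n} → Orient n → Orient n → Set
SameEdges {n} R A = ∀ {x y : Fin n} → x ≢ y → skel R x y ≡ skel A x y

-- Pointwise, an
-- out-edge v → y of R either disagrees with A or is an out-edge of A, and
-- a new disagreement x → v corresponds to an out-edge v → x of A.
Φ-reset : ∀ {n} (R A : Orient n) v → SameEdges R A →
          outdeg R v + Φ (reset R v) A ≤ Φ R A + (outdeg A v + outdeg A v)
Φ-reset R A v same = begin
  outdeg R v + Φ (reset R v) A                      ≡⟨ cong (_+ Φ (reset R v) A) (trans (outdeg-∑ R v) (sym (∑₂-row v ⟦ R ⟧))) ⟩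
  ∑₂ (row R) + Φ (reset R v) A                      ≡⟨ sym (∑₂-+ (row R) (disagree (reset R v) A)) ⟩
  ∑₂ (λ x y → row R x y + disagree (reset R v) A x y) ≤⟨ ∑₂-mono pointwise ⟩
  ∑₂ (λ x y → disagree R A x y + (row A x y + column A x y))
    ≡⟨ trans (∑₂-+ (disagree R A) _) (cong (Φ R A +_) (∑₂-+ (row A) (column A))) ⟩
  Φ R A + (∑₂ (row A) + ∑₂ (column A))             ≡⟨ cong (Φ R A +_) (cong₂ _+_ (∑₂-row v ⟦ A ⟧) (∑₂-column v ⟦ A ⟧)) ⟩
  Φ R A + (sum (⟦ A ⟧ v) + sum (⟦ A ⟧ v))           ≡⟨ cong (Φ R A +_) (sym (cong₂ _+_ (outdeg-∑ A v) (outdeg-∑ A v))) ⟩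
  Φ R A + (outdeg A v + outdeg A v)                 ∎
  where
  open ≤-Reasoning
  ⟦_⟧ : Orient _ → Fin _ → Fin _ → ℕ
  ⟦ O ⟧ x y = 𝟙 (O x y)
  row column : Orient _ → Fin _ → Fin _ → ℕ
  row O x y = 𝟙 (O x y) when (x =? v)
  column O x y = 𝟙 (O y x) when (y =? v)

  out-edge-split : ∀ r a → 𝟙 r ≤ 𝟙 (r ∧ not a) + 𝟙 a
  out-edge-split false a     = z≤n
  out-edge-split true  true  = ≤-refl
  out-edge-split true  false = ≤-refl

  new-in-edge : ∀ p q → 𝟙 ((p ∨ q) ∧ not p) ≤ 𝟙 q
  new-in-edge true  q     = z≤n
  new-in-edge false false = z≤n
  new-in-edge false true  = ≤-refl

  pointwise : ∀ x y → row R x y + disagree (reset R v) A x y ≤ disagree R A x y + (row A x y + column A x y)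
  pointwise x y with x ≟ v | y ≟ v
  ... | yes _ | _ =
    ≤-trans (≤-reflexive (+-identityʳ (𝟙 (R x y))))
            (≤-trans (out-edge-split (R x y) (A x y))
                     (+-monoʳ-≤ (disagree R A x y) (m≤m+n (𝟙 (A x y)) _)))
  ... | no x≢v | yes refl = ≤-trans (≤-reflexive (cong (λ t → 𝟙 (t ∧ not (A x y))) (same x≢v)))
                                    (≤-trans (new-in-edge (A x y) (A y x)) (m≤n+m _ _))
  ... | no _   | no _     = m≤m+n (disagree R A x y) 0

Drained : ∀ {n} → Orient n → Maybe (Fin n) → Set
Drained R nothing  = ⊤
Drained {n} R (just v) = (y : Fin n) → R v y ≡ false

record Invariant {n} (R A : Orient n) (c : Maybe (Fin n)) : Set where
  field
    sameEdges : SameEdges R A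
    drained   : Drained R c
open Invariant

-- A flip u → w raises Φ by at most what A pays for it: the flip is free
-- only during an operation at u, when R has no out-edge at u.
Φ-flip-charged : ∀ {n} (R A : Orient n) c u w → Drained R c → Φ R (flipEdge A u w) ≤ Φ R A + flipCost c u
Φ-flip-charged R A c u w drainedR = ≤-trans (Φ-flipEdge R A u w) (+-monoʳ-≤ (Φ R A) (paid c drainedR))
  where
  paid : ∀ c → Drained R c → 𝟙 (R u w) ≤ flipCost c u
  paid nothing  _ = 𝟙≤1 _
  paid (just v) Rv-drained with v ≟ u
  ... | yes refl = ≤-reflexive (cong 𝟙 (Rv-drained w))
  ... | no _     = 𝟙≤1 _

invariant-flip : ∀ {n} {R A : Orient n} {c u w} → Invariant R A c → A u w ≡ true →
                 Invariant R (flipEdge A u w) c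
invariant-flip {A = A} {u = u} {w} inv Auw = record
  { sameEdges = λ {x} {y} x≢y → trans (sameEdges inv x≢y) (sym (skel-flipEdge A u w x y Auw))
  ; drained   = drained inv
  }

invariant-ins : ∀ {n} {R A : Orient n} {c u w} b′ b → Invariant R A c →
                Invariant (orientIns R u w b′) (orientIns A u w b) nothing
invariant-ins {R = R} {A} {u = u} {w} b′ b inv = record
  { sameEdges = λ {x} {y} x≢y → begin
      skel (orientIns R u w b′) x y ≡⟨ skel-orientIns R u w b′ x y ⟩
      on u w x y ∨ skel R x y       ≡⟨ cong (on u w x y ∨_) (sameEdges inv x≢y) ⟩
      on u w x y ∨ skel A x y       ≡⟨ sym (skel-orientIns A u w b x y) ⟩
      skel (orientIns A u w b) x y  ∎
  ; drained   = tt
  }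
  where open ≡-Reasoning

invariant-del : ∀ {n} {R A : Orient n} {c} u w → Invariant R A c →
                Invariant (delEdge R u w) (delEdge A u w) nothing
invariant-del {R = R} {A} u w inv = record
  { sameEdges = λ {x} {y} x≢y → begin
      skel (delEdge R u w) x y      ≡⟨ skel-delEdge R u w x y ⟩
      not (on u w x y) ∧ skel R x y ≡⟨ cong (not (on u w x y) ∧_) (sameEdges inv x≢y) ⟩
      not (on u w x y) ∧ skel A x y ≡⟨ sym (skel-delEdge A u w x y) ⟩
      skel (delEdge A u w) x y      ∎
  ; drained   = tt
  }
  where open ≡-Reasoning

invariant-reset : ∀ {n} {R A : Orient n} {c} v → Invariant R A c → Invariant (reset R v) A (just v)
invariant-reset {R = R} v inv = record
  { sameEdges = λ x≢y → trans (skel-reset R v x≢y) (sameEdges inv x≢y)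
  ; drained   = reset-drains R v
  }

amortise : ∀ {kR k Φ₀ Φ₁ dR dA} → kR ≤ 2 * k + Φ₁ → dR + Φ₁ ≤ Φ₀ + (dA + dA) →
           dR + kR ≤ 2 * (dA + k) + Φ₀
amortise {kR} {k} {Φ₀} {Φ₁} {dR} {dA} rest step = begin
  dR + kR                ≤⟨ +-monoʳ-≤ dR rest ⟩
  dR + (2 * k + Φ₁)      ≡⟨ +-shuffle dR (2 * k) Φ₁ ⟩
  2 * k + (dR + Φ₁)      ≤⟨ +-monoʳ-≤ (2 * k) step ⟩
  2 * k + (Φ₀ + (dA + dA)) ≡⟨ regroup k Φ₀ dA ⟩
  2 * (dA + k) + Φ₀      ∎
  where
  open ≤-Reasoning
  regroup : ∀ k p d → 2 * k + (p + (d + d)) ≡ 2 * (d + k) + p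
  regroup = solve-∀

charge : ∀ {Φ₁ dR} Φ₀ d → Φ₁ ≤ Φ₀ + d → dR ≤ d → dR + Φ₁ ≤ Φ₀ + (d + d)
charge {Φ₁} {dR} Φ₀ d rise dR≤d = begin
  dR + Φ₁        ≤⟨ +-mono-≤ dR≤d rise ⟩
  d + (Φ₀ + d)   ≡⟨ +-shuffle d Φ₀ d ⟩
  Φ₀ + (d + d)   ∎
  where open ≤-Reasoning

simulate : ∀ {n} {R A : Orient n} {c σ kR kA} → Invariant R A c →
           RunR R σ kR → RunA A c σ kA → kR ≤ 2 * kA + Φ R A
simulate {R = R} {A} {c} inv runR (flip {k = k} u w Auw runA) =
  amortise {k = k} {dR = 0} {flipCost c u} (simulate (invariant-flip inv Auw) runR runA)
    (charge (Φ R A) (flipCost c u) (Φ-flip-charged R A c u w (drained inv)) z≤n)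
simulate inv done done = z≤n
simulate {R = R} {A} inv (ins u w b′ _ _ _ runR) (ins {k = k} .u .w b _ _ _ runA) =
  amortise {k = k} {dA = 1} (simulate (invariant-ins b′ b inv) runR runA)
    (charge (Φ R A) 1 (Φ-orientIns R A u w b′ b) ≤-refl)
simulate {R = R} {A} inv (del u w _ runR) (del {k = k} .u .w _ runA) =
  amortise {k = k} {dA = 1} (simulate (invariant-del u w inv) runR runA)
    (charge (Φ R A) 1 (≤-trans (Φ-delEdge R A u w) (m≤m+n (Φ R A) 1)) ≤-refl)
simulate {R = R} {A} inv (upd v runR) (upd {k = k} .v runA) =
  amortise {k = k} {dA = outdeg A v} (simulate (invariant-reset v inv) runR runA)
    (Φ-reset R A v (sameEdges inv))
simulate {R = R} {A} inv (qry v runR) (qry {k = k} .v runA) =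
  amortise {k = k} {dA = outdeg A v} (simulate (invariant-reset v inv) runR runA)
    (Φ-reset R A v (sameEdges inv))

-- Theorem 13.  Both runs start from O₀, so the initial potential is 0.
mainTheorem13 : ∀ {n : ℕ} (O₀ : Orient n) → WellFormed O₀ →
                (σ : List (Op n)) → ∀ {kR kA : ℕ} →
                RunR O₀ σ kR → RunA O₀ nothing σ kA → kR ≤ 2 * kA
mainTheorem13 O₀ _ σ {kR} {kA} runR runA =
  subst (kR ≤_) (trans (cong (2 * kA +_) (Φ-self O₀)) (+-identityʳ (2 * kA)))
        (simulate initial runR runA)
  where
  initial : Invariant O₀ O₀ nothing
  initial = record { sameEdges = λ _ → refl ; drained = tt }
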